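{- Let $P$ be an $n$-element poset and $L$ a labeling of $P$. For every integer $\gamma\geq 0$ and every $x\in\{2,\ldots,n\}$ we have $L_\gamma^{ -1}(x)\geq_P L_{\gamma+1}^{ -1}(x-1)$, and equality holds if and only if $L_\gamma^{ -1}(x)$ is not in the promotion chain of $L_\gamma$.
   Context: A labeling of an $n$-element poset $P$ is a bijection $L:P\to[n]=\{1,\dots,n\}$. For a labeling $L$ and a non-maximal $x\in P$, the $L$-successor of $x$ is the element of $\{y\in P: y>_P x\}$ with the smallest label. The promotion chain of $L$ is $v_1<_P v_2<_P\cdots<_P v_m$, where $v_1=L^{ -1}(1)$, $v_{i+1}$ is the $L$-successor of $v_i$, and $v_m$ is the first element reached that is maximal in $P$. Extended promotion is the map $\partial$ on labelings given by $\partial(L)(x)=L(x)-1$ if $x\notin\{v_1,\dots,v_m\}$, $\partial(L)(v_i)=L(v_{i+1})-1$ for $1\le i\le m-1$, and $\partial(L)(v_m)=n$. Write $L_\gamma=\partial^\gamma(L)$, with $L_0=L$. -}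

module Defs where

open import Data.Nat using (ℕ; zero; suc; _∸_; _≤_; _<ᵇ_)
open import Data.Fin using (Fin)
open import Data.Fin.Properties using (_≟_)
open import Data.List using (List; []; _∷_; filter; allFin)
open import Data.Maybe using (Maybe; just; nothing)
open import Data.Bool using (if_then_else_)
open import Data.Product using (_×_; _,_; ∃)
open import Relation.Binary.PropositionalEquality using (_≡_; _≢_)
open import Relation.Binary.Structures using (IsDecPartialOrder)
open import Relation.Nullary using (Dec; yes; no; ¬_)
open import Relation.Nullary.Decidable using (_×-dec_; ¬?)
open import Function.Definitions using (Injective)
open import Level using (0ℓ)

record FinPoset (n : ℕ) : Set₁ where
  field
    _≤P_ : Fin n → Fin n → Set
    isDecPartialOrder : IsDecPartialOrder _≡_ _≤P_
  open IsDecPartialOrder isDecPartialOrder public using () renaming (_≤?_ to _≤P?_)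

  _<P_ : Fin n → Fin n → Set
  x <P y = x ≤P y × x ≢ y

  _<P?_ : (x y : Fin n) → Dec (x <P y)
  x <P? y = (x ≤P? y) ×-dec ¬? (x ≟ y)

open FinPoset public

IsLabeling : (n : ℕ) → (Fin n → ℕ) → Set
IsLabeling n L =
  (∀ x → 1 ≤ L x × L x ≤ n) ×
  Injective _≡_ _≡_ L ×
  (∀ k → 1 ≤ k → k ≤ n → ∃ λ x → L x ≡ k)

module _ {n : ℕ} (P : FinPoset n) (L : Fin n → ℕ) where

  open import Data.List.Membership.DecPropositional (_≟_ {n}) using (_∈?_)

  minLabel : List (Fin n) → Maybe (Fin n)
  minLabel [] = nothing
  minLabel (x ∷ xs) with minLabel xs
  ... | nothing = just x
  ... | just y = if L y <ᵇ L x then just y else just x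

  above : Fin n → List (Fin n)
  above x = filter (λ y → _<P?_ P x y) (allFin n)

  successor : Fin n → Maybe (Fin n)
  successor x = minLabel (above x)

  firstElt : Maybe (Fin n)
  firstElt = minLabel (filter (λ y → L y Data.Nat.≟ 1) (allFin n))

  -- chain starting at v, following successors until a maximal element;
  -- with fuel n this is the full chain (a strict chain has at most n elements)
  chainFrom : ℕ → Fin n → List (Fin n)
  chainFrom zero v = v ∷ []
  chainFrom (suc k) v with successor v
  ... | nothing = v ∷ []
  ... | just w = v ∷ chainFrom k w

  promotionChain : List (Fin n)
  promotionChain with firstElt
  ... | nothing = []
  ... | just v = chainFrom n v

  promote : Fin n → ℕ
  promote x with x ∈? promotionChain
  ... | no _ = L x ∸ 1
  ... | yes _ with successor x
  ...   | nothing = n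
  ...   | just w = L w ∸ 1

promoteIter : {n : ℕ} → FinPoset n → ℕ → (Fin n → ℕ) → (Fin n → ℕ)
promoteIter P zero L = L
promoteIter P (suc γ) L = promote P (promoteIter P γ L)

{-# OPTIONS --safe #-}
-- Extended promotion lowers every label off the promotion chain v₁ < ⋯ < vₘ
-- by one, gives each vᵢ (i < m) the lowered label of vᵢ₊₁, and gives vₘ the
-- label n.  So ∂L is again injective with values in [1, n], and the element
-- carrying ∂L-label x − 1 is the one whose "source" label was x: y itself
-- when y = L⁻¹(x) is off the chain, and otherwise the chain predecessor of y
-- (y ≠ v₁, as v₁ has label 1 < x), which lies strictly below y.
module Submission where

open import Defs
open import Data.Nat using (ℕ; zero; suc; _≤_; _∸_; _<ᵇ_; z≤n; s≤s) renaming (_≟_ to _≟ℕ_)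
open import Data.Nat.Properties using (<-irrefl; ≤-refl; ≤-trans; m∸n≤m)
open import Data.Fin using (Fin)
open import Data.Fin.Properties using (_≟_; injective⇒≤)
open import Data.Bool using (true; false)
open import Data.Maybe using (Maybe; just; nothing)
open import Data.Maybe.Properties using (just-injective)
open import Data.List using (List; []; _∷_; length; lookup; allFin)
open import Data.List.Membership.Propositional using (_∈_; _∉_)
open import Data.List.Membership.Propositional.Properties
  using (∈-filter⁻; ∈-filter⁺; ∈-allFin; ∈-lookup)
open import Data.List.Relation.Unary.Any using (here; there)
open import Data.List.Relation.Unary.All as All using ([])
open import Data.List.Relation.Unary.AllPairs using ([]; _∷_)
open import Data.List.Relation.Unary.Unique.Propositional using (Unique)
open import Data.Product using (_×_; _,_; ∃; proj₁; proj₂)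
open import Data.Sum using (_⊎_; inj₁; inj₂)
open import Data.Empty using (⊥-elim)
open import Relation.Nullary using (¬_; yes; no)
open import Relation.Binary.PropositionalEquality
  using (_≡_; refl; sym; trans; cong; subst)
open import Relation.Binary.Structures using (IsDecPartialOrder)
open import Function.Bundles using (_⇔_; mk⇔)
open import Function.Definitions using (Injective)

∸1-injective : ∀ {p q} → 1 ≤ p → 1 ≤ q → p ∸ 1 ≡ q ∸ 1 → p ≡ q
∸1-injective {suc p} {suc q} _ _ eq = cong suc eq

∸1≢ : ∀ {p m} → 1 ≤ p → p ≤ m → ¬ (p ∸ 1 ≡ m)
∸1≢ {suc p} {suc m} _ (s≤s p≤m) refl = <-irrefl refl (s≤s p≤m)

1≤∸1 : ∀ {p} → 1 ≤ p → ¬ (p ≡ 1) → 1 ≤ p ∸ 1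
1≤∸1 {suc zero}    _ p≢1 = ⊥-elim (p≢1 refl)
1≤∸1 {suc (suc p)} _ _   = s≤s z≤n

lookup-injective : ∀ {A : Set} {xs : List A} → Unique xs → Injective _≡_ _≡_ (lookup xs)
lookup-injective {xs = _ ∷ _} (_ ∷ _) {Fin.zero} {Fin.zero} _ = refl
lookup-injective {xs = _ ∷ _} (x∉xs ∷ _) {Fin.zero} {Fin.suc j} eq =
  ⊥-elim (All.lookup x∉xs (∈-lookup j) eq)
lookup-injective {xs = _ ∷ _} (x∉xs ∷ _) {Fin.suc i} {Fin.zero} eq =
  ⊥-elim (All.lookup x∉xs (∈-lookup i) (sym eq))
lookup-injective {xs = _ ∷ _} (_ ∷ u) {Fin.suc i} {Fin.suc j} eq =
  cong Fin.suc (lookup-injective u eq)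

unique⇒length≤ : ∀ {n} {xs : List (Fin n)} → Unique xs → length xs ≤ n
unique⇒length≤ u = injective⇒≤ (lookup-injective u)

-- IsLabeling without its surjectivity component, which the argument never
-- uses; this weaker invariant is the one preserved by promotion.
record IsInjectiveLabeling (n : ℕ) (L : Fin n → ℕ) : Set where
  field
    label-range     : ∀ x → 1 ≤ L x × L x ≤ n
    label-injective : Injective _≡_ _≡_ L

  label-pos : ∀ x → 1 ≤ L x
  label-pos x = proj₁ (label-range x)

  label-≤ : ∀ x → L x ≤ n
  label-≤ x = proj₂ (label-range x)

  label∸1-injective : ∀ {a b} → L a ∸ 1 ≡ L b ∸ 1 → a ≡ b
  label∸1-injective eq = label-injective (∸1-injective (label-pos _) (label-pos _) eq)

isLabeling⇒isInjectiveLabeling : ∀ {n L} → IsLabeling n L → IsInjectiveLabeling n L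
isLabeling⇒isInjectiveLabeling (range , injective , _) = record
  { label-range = range ; label-injective = injective }

module Promotion {n : ℕ} (P : FinPoset n) (L : Fin n → ℕ) where
  open import Data.List.Membership.DecPropositional (_≟_ {n}) using (_∈?_)
  open IsDecPartialOrder (isDecPartialOrder P)
    using (antisym) renaming (refl to ≤P-refl; trans to ≤P-trans)

  private
    _≼_ : Fin n → Fin n → Set
    _≼_ = _≤P_ P
    succ : Fin n → Maybe (Fin n)
    succ = successor P L
    chain : ℕ → Fin n → List (Fin n)
    chain = chainFrom P L
    pc : List (Fin n)
    pc = promotionChain P L

  minLabel-∈ : ∀ xs {y} → minLabel P L xs ≡ just y → y ∈ xs
  minLabel-∈ [] ()
  minLabel-∈ (x ∷ xs) eq with minLabel P L xs in e
  minLabel-∈ (x ∷ xs) refl | nothing = here refl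
  ... | just z with L z <ᵇ L x
  minLabel-∈ (x ∷ xs) refl | just z | true  = there (minLabel-∈ xs e)
  minLabel-∈ (x ∷ xs) refl | just z | false = here refl

  ∈⇒minLabel-just : ∀ {x} xs → x ∈ xs → ∃ λ y → minLabel P L xs ≡ just y
  ∈⇒minLabel-just (x ∷ xs) _ with minLabel P L xs
  ... | nothing = x , refl
  ... | just z with L z <ᵇ L x
  ... | true  = z , refl
  ... | false = x , refl

  successor-< : ∀ {v w} → succ v ≡ just w → _<P_ P v w
  successor-< {v} e =
    proj₂ (∈-filter⁻ (λ y → _<P?_ P v y) {xs = allFin n} (minLabel-∈ (above P L v) e))

  successor-≰ : ∀ {b w} → succ b ≡ just w → ¬ (w ≼ b)
  successor-≰ e w≤b with successor-< e
  ... | b≤w , b≢w = b≢w (antisym b≤w w≤b)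

  head∈chainFrom : ∀ k v → v ∈ chain k v
  head∈chainFrom zero    v = here refl
  head∈chainFrom (suc k) v with succ v
  ... | nothing = here refl
  ... | just _  = here refl

  chainFrom-≥head : ∀ k v {b} → b ∈ chain k v → v ≼ b
  chainFrom-≥head zero v (here refl) = ≤P-refl
  chainFrom-≥head (suc k) v b∈ with succ v in e
  chainFrom-≥head (suc k) v (here refl) | nothing = ≤P-refl
  chainFrom-≥head (suc k) v (here refl) | just w  = ≤P-refl
  chainFrom-≥head (suc k) v (there b∈) | just w =
    ≤P-trans (proj₁ (successor-< e)) (chainFrom-≥head k w b∈)

  chainFrom-predecessor : ∀ k v {b} → b ∈ chain k v →
    b ≡ v ⊎ ∃ λ u → u ∈ chain k v × succ u ≡ just b
  chainFrom-predecessor zero v (here refl) = inj₁ refl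
  chainFrom-predecessor (suc k) v b∈ with succ v in e
  chainFrom-predecessor (suc k) v (here refl) | nothing = inj₁ refl
  chainFrom-predecessor (suc k) v (here refl) | just w  = inj₁ refl
  chainFrom-predecessor (suc k) v (there b∈) | just w with chainFrom-predecessor k w b∈
  ... | inj₁ refl              = inj₂ (v , here refl , e)
  ... | inj₂ (u , u∈ , succ-u) = inj₂ (u , there u∈ , succ-u)

  chainFrom-maximal-unique : ∀ k v {a b} → a ∈ chain k v → b ∈ chain k v →
    succ a ≡ nothing → succ b ≡ nothing → a ≡ b
  chainFrom-maximal-unique zero v (here refl) (here refl) _ _ = refl
  chainFrom-maximal-unique (suc k) v a∈ b∈ sa sb with succ v in e
  chainFrom-maximal-unique (suc k) v (here refl) (here refl) _ _ | nothing = refl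
  chainFrom-maximal-unique (suc k) v (here refl) _ sa _ | just w with () ← trans (sym e) sa
  chainFrom-maximal-unique (suc k) v (there _) (here refl) _ sb | just w with () ← trans (sym e) sb
  chainFrom-maximal-unique (suc k) v (there a∈) (there b∈) sa sb | just w =
    chainFrom-maximal-unique k w a∈ b∈ sa sb

  chainFrom-successor-injective : ∀ k v {a b w} → a ∈ chain k v → b ∈ chain k v →
    succ a ≡ just w → succ b ≡ just w → a ≡ b
  chainFrom-successor-injective zero v (here refl) (here refl) _ _ = refl
  chainFrom-successor-injective (suc k) v a∈ b∈ sa sb with succ v in e
  chainFrom-successor-injective (suc k) v (here refl) (here refl) _ _ | nothing = refl
  chainFrom-successor-injective (suc k) v (here refl) (here refl) _ _ | just _  = refl
  chainFrom-successor-injective (suc k) v (here refl) (there b∈) sa sb | just w₀ =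
    ⊥-elim (successor-≰ sb (subst (_≼ _) (just-injective (trans (sym e) sa))
                                             (chainFrom-≥head k w₀ b∈)))
  chainFrom-successor-injective (suc k) v (there a∈) (here refl) sa sb | just w₀ =
    ⊥-elim (successor-≰ sa (subst (_≼ _) (just-injective (trans (sym e) sb))
                                             (chainFrom-≥head k w₀ a∈)))
  chainFrom-successor-injective (suc k) v (there a∈) (there b∈) sa sb | just w₀ =
    chainFrom-successor-injective k w₀ a∈ b∈ sa sb

  SuccessorClosed : List (Fin n) → Set
  SuccessorClosed xs = ∀ {b w} → b ∈ xs → succ b ≡ just w → w ∈ xs

  chainFrom-closed⊎full : ∀ k v → SuccessorClosed (chain k v) ⊎ length (chain k v) ≡ suc k
  chainFrom-closed⊎full zero v = inj₂ refl
  chainFrom-closed⊎full (suc k) v with succ v in e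
  ... | nothing = inj₁ λ { (here refl) sb → ⊥-elim (nothing≢just (trans (sym e) sb)) }
    where
    nothing≢just : ∀ {w} → ¬ (nothing ≡ just w)
    nothing≢just ()
  ... | just w₀ with chainFrom-closed⊎full k w₀
  ... | inj₂ full   = inj₂ (cong suc full)
  ... | inj₁ closed = inj₁ λ
    { (here refl) sb → there (subst (_∈ chain k w₀) (just-injective (trans (sym e) sb))
                                    (head∈chainFrom k w₀))
    ; (there b∈) sb → there (closed b∈ sb) }

  chainFrom-unique : ∀ k v → Unique (chain k v)
  chainFrom-unique zero v = [] ∷ []
  chainFrom-unique (suc k) v with succ v in e
  ... | nothing = [] ∷ []
  ... | just w₀ =
    All.tabulate (λ b∈ v≡b → successor-≰ e (subst (w₀ ≼_) (sym v≡b) (chainFrom-≥head k w₀ b∈)))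
    ∷ chainFrom-unique k w₀

  -- A strict chain in an n-element poset cannot have n + 1 elements, so fuel n suffices.
  chainFrom-closed : ∀ v → SuccessorClosed (chain n v)
  chainFrom-closed v with chainFrom-closed⊎full n v
  ... | inj₁ closed = closed
  ... | inj₂ full   =
    ⊥-elim (<-irrefl refl (subst (_≤ n) full (unique⇒length≤ (chainFrom-unique n v))))

  firstElt-label : ∀ {v} → firstElt P L ≡ just v → L v ≡ 1
  firstElt-label e = proj₂ (∈-filter⁻ (λ y → L y ≟ℕ 1) {xs = allFin n} (minLabel-∈ _ e))

  label1⇒firstElt : ∀ {a} → L a ≡ 1 → ∃ λ v → firstElt P L ≡ just v
  label1⇒firstElt {a} La≡1 = ∈⇒minLabel-just _ (∈-filter⁺ (λ y → L y ≟ℕ 1) (∈-allFin a) La≡1)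

  promotionChain≡chainFrom : ∀ {v} → firstElt P L ≡ just v → pc ≡ chain n v
  promotionChain≡chainFrom e with firstElt P L
  promotionChain≡chainFrom refl | just _ = refl

  ∈promotionChain : ∀ {a} → a ∈ pc → ∃ λ v → firstElt P L ≡ just v × a ∈ chain n v
  ∈promotionChain a∈ with firstElt P L
  ∈promotionChain () | nothing
  ∈promotionChain a∈ | just v = v , refl , a∈

  chainFrom⊆promotionChain : ∀ {v a} → firstElt P L ≡ just v → a ∈ chain n v → a ∈ pc
  chainFrom⊆promotionChain {a = a} e = subst (a ∈_) (sym (promotionChain≡chainFrom e))

  promotionChain-closed : SuccessorClosed pc
  promotionChain-closed b∈ sb with ∈promotionChain b∈
  ... | v , e , b∈′ = chainFrom⊆promotionChain e (chainFrom-closed v b∈′ sb)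

  promotionChain-maximal-unique : ∀ {a b} → a ∈ pc → b ∈ pc →
    succ a ≡ nothing → succ b ≡ nothing → a ≡ b
  promotionChain-maximal-unique {b = b} a∈ b∈ with ∈promotionChain a∈
  ... | v , e , a∈′ =
    chainFrom-maximal-unique n v a∈′ (subst (b ∈_) (promotionChain≡chainFrom e) b∈)

  promotionChain-successor-injective : ∀ {a b w} → a ∈ pc → b ∈ pc →
    succ a ≡ just w → succ b ≡ just w → a ≡ b
  promotionChain-successor-injective {b = b} a∈ b∈ with ∈promotionChain a∈
  ... | v , e , a∈′ =
    chainFrom-successor-injective n v a∈′ (subst (b ∈_) (promotionChain≡chainFrom e) b∈)

  promotionChain-predecessor : ∀ {b} → b ∈ pc →
    L b ≡ 1 ⊎ ∃ λ u → u ∈ pc × succ u ≡ just b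
  promotionChain-predecessor b∈ with ∈promotionChain b∈
  ... | v , e , b∈′ with chainFrom-predecessor n v b∈′
  ... | inj₁ refl              = inj₁ (firstElt-label e)
  ... | inj₂ (u , u∈ , succ-u) = inj₂ (u , chainFrom⊆promotionChain e u∈ , succ-u)

  module _ (L-injective : Injective _≡_ _≡_ L) where

    label1∈promotionChain : ∀ {a} → L a ≡ 1 → a ∈ pc
    label1∈promotionChain {a} La≡1 with label1⇒firstElt La≡1
    ... | v , e = subst (_∈ pc) (L-injective (trans (firstElt-label e) (sym La≡1)))
                        (chainFrom⊆promotionChain e (head∈chainFrom n v))

    promotionChain-≥label1 : ∀ {a b} → a ∈ pc → L b ≡ 1 → b ≼ a
    promotionChain-≥label1 {b = b} a∈ Lb≡1 with ∈promotionChain a∈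
    ... | v , e , a∈′ =
      subst (_≼ _) (L-injective (trans (firstElt-label e) (sym Lb≡1))) (chainFrom-≥head n v a∈′)

  promote-∉ : ∀ {x} → x ∉ pc → promote P L x ≡ L x ∸ 1
  promote-∉ {x} x∉ with x ∈? pc
  ... | yes x∈ = ⊥-elim (x∉ x∈)
  ... | no _   = refl

  promote-maximal : ∀ {x} → x ∈ pc → succ x ≡ nothing → promote P L x ≡ n
  promote-maximal {x} x∈ sx with x ∈? pc
  ... | no x∉ = ⊥-elim (x∉ x∈)
  ... | yes _ with succ x
  promote-maximal x∈ refl | yes _ | nothing = refl

  promote-successor : ∀ {x w} → x ∈ pc → succ x ≡ just w → promote P L x ≡ L w ∸ 1
  promote-successor {x} x∈ sx with x ∈? pc
  ... | no x∉ = ⊥-elim (x∉ x∈)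
  ... | yes _ with succ x
  promote-successor x∈ refl | yes _ | just _ = refl

  data PromoteView (x : Fin n) : Set where
    off-chain : x ∉ pc → promote P L x ≡ L x ∸ 1 → PromoteView x
    maximal   : x ∈ pc → succ x ≡ nothing → promote P L x ≡ n → PromoteView x
    inner     : ∀ w → x ∈ pc → succ x ≡ just w → promote P L x ≡ L w ∸ 1 → PromoteView x

  promote-view : ∀ x → PromoteView x
  promote-view x with x ∈? pc
  ... | no x∉ = off-chain x∉ (promote-∉ x∉)
  ... | yes x∈ with succ x in sx
  ... | nothing = maximal x∈ sx (promote-maximal x∈ sx)
  ... | just w  = inner w x∈ sx (promote-successor x∈ sx)

  module _ (isL : IsInjectiveLabeling n L) where
    open IsInjectiveLabeling isL

    promote-range : ∀ x → 1 ≤ promote P L x × promote P L x ≤ n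
    promote-range x with promote-view x
    ... | off-chain x∉ eq rewrite eq =
      1≤∸1 (label-pos x) (λ Lx≡1 → x∉ (label1∈promotionChain label-injective Lx≡1)) ,
      ≤-trans (m∸n≤m _ 1) (label-≤ x)
    ... | maximal _ _ eq rewrite eq = ≤-trans (label-pos x) (label-≤ x) , ≤-refl
    ... | inner w x∈ sx eq rewrite eq =
      1≤∸1 (label-pos w)
           (λ Lw≡1 → successor-≰ sx (promotionChain-≥label1 label-injective x∈ Lw≡1)) ,
      ≤-trans (m∸n≤m _ 1) (label-≤ w)

    -- Off the chain, a lowered own label never equals n (that is vₘ's) nor the
    -- lowered label of a chain successor (which lies on the chain).
    promote-injective : Injective _≡_ _≡_ (promote P L)
    promote-injective {a} {b} eq with promote-view a | promote-view b
    ... | off-chain _ ea | off-chain _ eb =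
      label∸1-injective (trans (sym ea) (trans eq eb))
    ... | off-chain _ ea | maximal _ _ eb =
      ⊥-elim (∸1≢ (label-pos a) (label-≤ a) (trans (sym ea) (trans eq eb)))
    ... | off-chain a∉ ea | inner w b∈ sb eb =
      ⊥-elim (a∉ (subst (_∈ pc) (sym (label∸1-injective (trans (sym ea) (trans eq eb))))
                               (promotionChain-closed b∈ sb)))
    ... | maximal _ _ ea | off-chain _ eb =
      ⊥-elim (∸1≢ (label-pos b) (label-≤ b) (trans (sym eb) (trans (sym eq) ea)))
    ... | maximal a∈ sa _ | maximal b∈ sb _ = promotionChain-maximal-unique a∈ b∈ sa sb
    ... | maximal _ _ ea | inner w _ _ eb =
      ⊥-elim (∸1≢ (label-pos w) (label-≤ w) (trans (sym eb) (trans (sym eq) ea)))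
    ... | inner w a∈ sa ea | off-chain b∉ eb =
      ⊥-elim (b∉ (subst (_∈ pc) (label∸1-injective (trans (sym ea) (trans eq eb)))
                               (promotionChain-closed a∈ sa)))
    ... | inner w _ _ ea | maximal _ _ eb =
      ⊥-elim (∸1≢ (label-pos w) (label-≤ w) (trans (sym ea) (trans eq eb)))
    ... | inner w a∈ sa ea | inner w′ b∈ sb eb =
      promotionChain-successor-injective a∈ b∈ sa
        (subst (λ t → succ b ≡ just t)
               (sym (label∸1-injective (trans (sym ea) (trans eq eb)))) sb)

    promote-isInjectiveLabeling : IsInjectiveLabeling n (promote P L)
    promote-isInjectiveLabeling = record
      { label-range = promote-range ; label-injective = promote-injective }

    promote-preimage : ∀ {x} → 2 ≤ x → (y z : Fin n) → L y ≡ x → promote P L z ≡ x ∸ 1 →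
      z ≼ y × ((y ≡ z) ⇔ (y ∉ pc))
    promote-preimage {x} 2≤x y z Ly≡x ∂Lz≡x∸1 with y ∈? pc
    ... | no y∉ with promote-injective (trans (promote-∉ y∉)
                                       (trans (cong (_∸ 1) Ly≡x) (sym ∂Lz≡x∸1)))
    ...   | refl = ≤P-refl , mk⇔ (λ _ → y∉) (λ _ → refl)
    promote-preimage {x} 2≤x y z Ly≡x ∂Lz≡x∸1 | yes y∈ with promotionChain-predecessor y∈
    ... | inj₁ Ly≡1 with s≤s () ← subst (2 ≤_) (trans (sym Ly≡x) Ly≡1) 2≤x
    ... | inj₂ (u , u∈ , su) with promote-injective (trans (promote-successor u∈ su)
                                                 (trans (cong (_∸ 1) Ly≡x) (sym ∂Lz≡x∸1)))
    ...   | refl = proj₁ (successor-< su) ,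
                   mk⇔ (λ y≡u → ⊥-elim (proj₂ (successor-< su) (sym y≡u))) (λ y∉ → ⊥-elim (y∉ y∈))

promoteIter-isInjectiveLabeling : ∀ {n} (P : FinPoset n) {L : Fin n → ℕ} →
  IsInjectiveLabeling n L → ∀ γ → IsInjectiveLabeling n (promoteIter P γ L)
promoteIter-isInjectiveLabeling P isL zero    = isL
promoteIter-isInjectiveLabeling P isL (suc γ) =
  Promotion.promote-isInjectiveLabeling P _ (promoteIter-isInjectiveLabeling P isL γ)

lemma2p7 : {n : ℕ} (P : FinPoset n) (L : Fin n → ℕ) → IsLabeling n L →
    (γ x : ℕ) → 2 ≤ x → x ≤ n →
    (y z : Fin n) → promoteIter P γ L y ≡ x → promoteIter P (suc γ) L z ≡ x ∸ 1 →
    _≤P_ P z y × ((y ≡ z) ⇔ (y ∉ promotionChain P (promoteIter P γ L)))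
lemma2p7 P L isLabeling γ x 2≤x _ =
  Promotion.promote-preimage P (promoteIter P γ L)
    (promoteIter-isInjectiveLabeling P (isLabeling⇒isInjectiveLabeling isLabeling) γ) 2≤x
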